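{- Let $\pi\in S_n(1423)$ with $\pi\neq n(n-1)\ldots 1$, let $\phi(\pi)=(a,b)$, and let $m=a+\rho(\pi)+1$ and $l=n-a-\rho(\pi)$ (so $m=|\pi^{(1)}|$ and $l=|\pi^{(2)}|$). Then $\operatorname{RLmax}\pi^{(1)}=\bigl(\operatorname{RLmax}\pi\setminus[b,n]\bigr)\cup[a+1,m]$ and $\operatorname{RLmax}\pi^{(2)}=[b-a,l]$.
   Context: $[x,y]=\{x,x+1,\dots,y\}$. For a sequence of distinct integers, $\mathrm{std}$ of it is the unique permutation order-isomorphic to it. $S_n(1423)$ is the set of permutations in $S_n$ with no subsequence order-isomorphic to $1423$. $\operatorname{RLmax}\pi$ is the set of indices $i$ with $\pi_i>\pi_j$ for all $j>i$ (right-to-left maxima). For $\pi\in S_n$, $\pi\ne n(n-1)\ldots1$, define $\phi(\pi)=(a,b)$: $b$ is the smallest index with $[b,n]\subseteq\operatorname{RLmax}\pi$; if $\operatorname{RLmax}\pi=[b,n]$ then $a=0$, otherwise $a=\max(\operatorname{RLmax}\pi\setminus[b,n])$. Further $\chi(\pi)=\max\{\pi_i:a<i<b\}$, $\rho(\pi)=|\{i\in\operatorname{RLmax}\pi: i>b,\ \pi_i>\chi(\pi)\}|$, $\pi^{(1)}=\mathrm{std}(\pi_1\ldots\pi_a\pi_b\pi_{b+1}\ldots\pi_{b+\rho(\pi)})$ and $\pi^{(2)}=\mathrm{std}(\pi_{a+1}\ldots\pi_b\pi_{b+\rho(\pi)+1}\ldots\pi_n)$. -}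

module Defs where

open import Data.Nat using (ℕ; zero; suc; _+_; _∸_; _≤_; _<_; _⊔_; _<ᵇ_; _≤ᵇ_)
open import Data.Bool using (Bool; true; false; _∧_)
open import Data.List using (List; []; _∷_; length; map; foldr; applyUpTo; reverse; _++_)
open import Data.Bool using (if_then_else_)
open import Data.List.Relation.Binary.Permutation.Propositional using (_↭_)
open import Data.Product using (_×_)
open import Data.Sum using (_⊎_)
open import Relation.Nullary using (¬_)
open import Relation.Binary.PropositionalEquality using (_≡_)
open import Function.Bundles using (_⇔_)

-- Conventions: a permutation of [1,n] is a list of naturals (one-line notation,
-- values 1..n); positions are 1-based.

-- [x,y] = {x, x+1, ..., y} as a list (empty if y < x)
range : ℕ → ℕ → List ℕ
range lo hi = applyUpTo (lo +_) (suc hi ∸ lo)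

-- π_i (1-based); 0 outside [1, |π|]
at : List ℕ → ℕ → ℕ
at []       _             = 0
at (x ∷ xs) zero          = 0
at (x ∷ xs) (suc zero)    = x
at (x ∷ xs) (suc (suc i)) = at xs (suc i)

filterᵇ : (ℕ → Bool) → List ℕ → List ℕ
filterᵇ p []       = []
filterᵇ p (x ∷ xs) = if p x then x ∷ filterᵇ p xs else filterᵇ p xs

allᵇ : (ℕ → Bool) → List ℕ → Bool
allᵇ p []       = true
allᵇ p (x ∷ xs) = p x ∧ allᵇ p xs

IsPerm : ℕ → List ℕ → Set
IsPerm n π = π ↭ range 1 n

decr : ℕ → List ℕ
decr n = reverse (range 1 n)

Avoids1423 : List ℕ → Set
Avoids1423 π = ∀ i j k l → 1 ≤ i → i < j → j < k → k < l → l ≤ length π →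
  ¬ (at π i < at π k × at π k < at π l × at π l < at π j)

-- std: the permutation order-isomorphic to a sequence of distinct integers
std : List ℕ → List ℕ
std xs = map (λ x → suc (length (filterᵇ (λ y → y <ᵇ x) xs))) xs

isRL : List ℕ → ℕ → Bool
isRL π i = (1 ≤ᵇ i) ∧ ((i ≤ᵇ length π) ∧ allᵇ (λ j → at π j <ᵇ at π i) (range (suc i) (length π)))

RLmax : List ℕ → ℕ → Set
RLmax π i = isRL π i ≡ true

maxL : List ℕ → ℕ
maxL = foldr _⊔_ 0

-- φ(π) = (a , b)
-- b : smallest index in [1,n] with [b,n] ⊆ RLmax π
phiB : List ℕ → ℕ
phiB π with filterᵇ (λ b → allᵇ (isRL π) (range b (length π))) (range 1 (length π))
... | []    = length π
... | b ∷ _ = b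

-- a : max (RLmax π \ [b,n]) = max (RLmax π ∩ [1,b-1]), or 0 if that set is empty
phiA : List ℕ → ℕ
phiA π = maxL (filterᵇ (isRL π) (range 1 (phiB π ∸ 1)))

chi : List ℕ → ℕ
chi π = maxL (map (at π) (range (suc (phiA π)) (phiB π ∸ 1)))

rho : List ℕ → ℕ
rho π = length (filterᵇ (λ i → isRL π i ∧ (chi π <ᵇ at π i)) (range (suc (phiB π)) (length π)))

pi1 : List ℕ → List ℕ
pi1 π = std (map (at π) (range 1 (phiA π) ++ range (phiB π) (phiB π + rho π)))

pi2 : List ℕ → List ℕ
pi2 π = std (map (at π) (range (suc (phiA π)) (phiB π) ++ range (suc (phiB π + rho π)) (length π)))

module Submission where

-- Every position of [b, n] is a right-to-left maximum of π, b − 1 is not one (so b ≥ 2, since π is not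
-- decreasing), and neither is any position strictly between a and b; the largest value χ there lies below
-- π_b. As π decreases on [b, n], the positions i > b with π_i > χ are exactly those in (b, b + ρ].
-- Both π^(1) and π^(2) standardise the restriction of π to an increasing list of indices, so a position
-- is a right-to-left maximum of them iff the index it carries beats every later chosen index. For π^(1),
-- an index i ≤ a beats the chosen indices iff it beats all later ones, because every skipped index j has
-- π_j ≤ χ < π_b while b is chosen; the chosen block [b, b + ρ] consists of right-to-left maxima of π.
-- For π^(2), the chosen indices from b on are right-to-left maxima of π, whereas an index k in (a, b) is
-- beaten by some later j, and if j falls into the skipped block (b, b + ρ] then π_b > π_j ≥ π_k with b
-- chosen.

open import Defs

open import Data.Bool using (Bool; true; false; _∧_)
open import Data.Bool.Properties using (T-≡)
open import Data.List using (List; []; _∷_; length; map; applyUpTo; _++_)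
open import Data.List.Properties using (length-applyUpTo; length-map; length-++; reverse-applyUpTo)
open import Data.List.Membership.Propositional using (_∈_)
open import Data.List.Membership.Propositional.Properties
  using (∈-applyUpTo⁺; ∈-applyUpTo⁻; ∈-map⁺; ∈-map⁻; ∈-++⁺ˡ; ∈-++⁺ʳ; ∈-++⁻)
open import Data.List.Relation.Unary.Any using (here; there)
open import Data.List.Relation.Unary.All as All using (All)
open import Data.List.Relation.Unary.AllPairs as AllPairs using (AllPairs; []; _∷_)
import Data.List.Relation.Unary.AllPairs.Properties as AllPairs
open import Data.List.Relation.Unary.Unique.Propositional using (Unique)
open import Data.List.Relation.Unary.Sorted.TotalOrder using (Sorted)
open import Data.List.Relation.Unary.Sorted.TotalOrder.Properties using (↗↭↗⇒≋; AllPairs⇒Sorted)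
open import Data.List.Relation.Binary.Equality.Propositional using (≋⇒≡)
open import Data.List.Relation.Binary.Permutation.Propositional using (↭⇒↭ₛ; ↭-sym; ↭-trans)
open import Data.List.Relation.Binary.Permutation.Propositional.Properties using (↭-reverse; ↭-length)
open import Data.Nat using (ℕ; zero; suc; _+_; _∸_; _≤_; _<_; _>_; _≤ᵇ_; _<ᵇ_; z≤n; s≤s; z<s; s≤s⁻¹; s<s⁻¹)
open import Data.Nat.Properties
open import Data.Nat.Solver using (module +-*-Solver)
open import Data.Product using (_×_; _,_; proj₁; proj₂; map₁; map₂; ∃-syntax)
open import Data.Sum using (_⊎_; inj₁; inj₂)
open import Function.Base using (_∘_)
open import Function.Bundles using (_⇔_; mk⇔; Equivalence)
open import Function.Properties.Equivalence using () renaming (sym to ⇔-sym; trans to ⇔-trans)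
open import Relation.Binary.Definitions using (tri<; tri≈; tri>)
open import Relation.Binary.Properties.TotalOrder ≤-totalOrder using (≥-totalOrder)
open import Relation.Binary.PropositionalEquality
  using (_≡_; _≢_; refl; sym; trans; cong; cong₂; subst; subst₂; setoid; module ≡-Reasoning)
open import Data.List.Relation.Binary.Permutation.Setoid.Properties (setoid ℕ) using (Unique-resp-↭)
open import Relation.Nullary using (¬_; yes; no; contradiction)

open Equivalence using (to; from)

≤∸1⇔< : ∀ {i b} → 1 ≤ b → i ≤ b ∸ 1 ⇔ i < b
≤∸1⇔< {b = suc b} _ = mk⇔ s≤s s≤s⁻¹

∸-split : ∀ a b r n → a ≤ b → b + r ≤ n → (b ∸ a) + (n ∸ (b + r)) ≡ n ∸ a ∸ r
∸-split a _ r _ a≤b b+r≤n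
  with d , refl ← m≤n⇒∃[o]m+o≡n a≤b with e , refl ← m≤n⇒∃[o]m+o≡n b+r≤n = begin
    (a + d ∸ a) + (a + d + r + e ∸ (a + d + r)) ≡⟨ cong₂ _+_ (m+n∸m≡n a d) (m+n∸m≡n (a + d + r) e) ⟩
    d + e                                       ≡⟨ sym (m+n∸m≡n r (d + e)) ⟩
    r + (d + e) ∸ r                             ≡⟨ cong (_∸ r) (sym (m+n∸m≡n a (r + (d + e)))) ⟩
    a + (r + (d + e)) ∸ a ∸ r                   ≡⟨ cong (λ m → m ∸ a ∸ r) (rearrange a d r e) ⟩
    a + d + r + e ∸ a ∸ r                       ∎
  where
  open ≡-Reasoning
  open +-*-Solver
  rearrange : ∀ a d r e → a + (r + (d + e)) ≡ a + d + r + e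
  rearrange = solve 4 (λ a d r e → a :+ (r :+ (d :+ e)) := a :+ d :+ r :+ e) refl

∧≡true⁻ : ∀ {x y} → x ∧ y ≡ true → x ≡ true × y ≡ true
∧≡true⁻ {true} y≡true = refl , y≡true

∧≡true⁺ : ∀ {x y} → x ≡ true → y ≡ true → x ∧ y ≡ true
∧≡true⁺ refl y≡true = y≡true

false≢true : ∀ {x} → x ≡ false → x ≢ true
false≢true refl ()

<ᵇ⇔< : ∀ {m n} → (m <ᵇ n) ≡ true ⇔ m < n
<ᵇ⇔< {m} {n} = mk⇔ (<ᵇ⇒< m n ∘ from T-≡) (to T-≡ ∘ <⇒<ᵇ)

≤ᵇ⇔≤ : ∀ {m n} → (m ≤ᵇ n) ≡ true ⇔ m ≤ n
≤ᵇ⇔≤ {m} {n} = mk⇔ (≤ᵇ⇒≤ m n ∘ from T-≡) (to T-≡ ∘ ≤⇒≤ᵇ)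

at-applyUpTo : ∀ (f : ℕ → ℕ) {k t} → t < k → at (applyUpTo f k) (suc t) ≡ f t
at-applyUpTo f {suc k} {zero}  _   = refl
at-applyUpTo f {suc k} {suc t} t<k = at-applyUpTo (f ∘ suc) (s<s⁻¹ t<k)

at-map : ∀ (f : ℕ → ℕ) xs {t} → t < length xs → at (map f xs) (suc t) ≡ f (at xs (suc t))
at-map f (_ ∷ _)  {zero}  _   = refl
at-map f (_ ∷ xs) {suc t} t<n = at-map f xs (s<s⁻¹ t<n)

at-++ˡ : ∀ {xs ys t} → t < length xs → at (xs ++ ys) (suc t) ≡ at xs (suc t)
at-++ˡ {_ ∷ _}  {t = zero}  _   = refl
at-++ˡ {_ ∷ xs} {t = suc t} t<n = at-++ˡ {xs} (s<s⁻¹ t<n)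

at-++ʳ : ∀ xs {ys t} → at (xs ++ ys) (length xs + suc t) ≡ at ys (suc t)
at-++ʳ []           = refl
at-++ʳ (_ ∷ [])     = refl
at-++ʳ (_ ∷ y ∷ xs) = at-++ʳ (y ∷ xs)

at-∈ : ∀ xs {t} → t < length xs → at xs (suc t) ∈ xs
at-∈ (_ ∷ _)  {zero}  _   = here refl
at-∈ (_ ∷ xs) {suc t} t<n = there (at-∈ xs (s<s⁻¹ t<n))

∈⇒at : ∀ {x xs} → x ∈ xs → ∃[ t ] t < length xs × at xs (suc t) ≡ x
∈⇒at (here refl) = zero , z<s , refl
∈⇒at (there x∈) with t , t<n , eq ← ∈⇒at x∈ = suc t , s≤s t<n , eq

at-++-∈ʳ : ∀ xs {ys i} → length xs < i → i ≤ length (xs ++ ys) → at (xs ++ ys) i ∈ ys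
at-++-∈ʳ xs {ys} n<i i≤ with t , refl ← m≤n⇒∃[o]m+o≡n n<i =
  subst (_∈ ys) (sym (trans (cong (at (xs ++ ys)) (sym (+-suc (length xs) t))) (at-++ʳ xs)))
        (at-∈ ys (+-cancelˡ-< (length xs) t _ (subst (suc (length xs + t) ≤_) (length-++ xs) i≤)))

AllPairs⇔at : ∀ {R : ℕ → ℕ → Set} {xs} →
  AllPairs R xs ⇔ (∀ {t u} → t < u → u < length xs → R (at xs (suc t)) (at xs (suc u)))
AllPairs⇔at {R} = mk⇔ sound complete
  where
  sound : ∀ {xs} → AllPairs R xs → ∀ {t u} → t < u → u < length xs → R (at xs (suc t)) (at xs (suc u))
  sound (Rx ∷ _)  {zero}  {suc u} _   u<n = All.lookup Rx (at-∈ _ (s<s⁻¹ u<n))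
  sound (_ ∷ Rxs) {suc t} {suc u} t<u u<n = sound Rxs (s<s⁻¹ t<u) (s<s⁻¹ u<n)
  complete : ∀ {xs} → (∀ {t u} → t < u → u < length xs → R (at xs (suc t)) (at xs (suc u))) → AllPairs R xs
  complete {[]}     _  = []
  complete {x ∷ xs} Rt = All.tabulate head ∷ complete (λ t<u u<n → Rt (s≤s t<u) (s≤s u<n))
    where
    head : ∀ {y} → y ∈ xs → R x y
    head y∈ with u , u<n , refl ← ∈⇒at y∈ = Rt z<s (s≤s u<n)

AllPairs-<⇒ : ∀ {R : ℕ → ℕ → Set} {xs} → AllPairs _<_ xs →
              (∀ {x y} → x ∈ xs → y ∈ xs → x < y → R x y) → AllPairs R xs
AllPairs-<⇒ {xs = xs} increasing R< = from AllPairs⇔at λ t<u u<n →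
  R< (at-∈ xs (<-trans t<u u<n)) (at-∈ xs u<n) (to AllPairs⇔at increasing t<u u<n)

module _ {p : ℕ → Bool} where

  allᵇ⇔ : ∀ {xs} → allᵇ p xs ≡ true ⇔ (∀ {x} → x ∈ xs → p x ≡ true)
  allᵇ⇔ = mk⇔ sound complete
    where
    sound : ∀ {xs} → allᵇ p xs ≡ true → ∀ {x} → x ∈ xs → p x ≡ true
    sound {y ∷ _} all (here refl) = proj₁ (∧≡true⁻ all)
    sound {y ∷ _} all (there x∈)  = sound (proj₂ (∧≡true⁻ {p y} all)) x∈
    complete : ∀ {xs} → (∀ {x} → x ∈ xs → p x ≡ true) → allᵇ p xs ≡ true
    complete {[]}    _   = refl
    complete {_ ∷ _} all = ∧≡true⁺ (all (here refl)) (complete (all ∘ there))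

  allᵇ≢true⇒∃ : ∀ xs → allᵇ p xs ≢ true → ∃[ x ] x ∈ xs × p x ≢ true
  allᵇ≢true⇒∃ []       ¬all = contradiction refl ¬all
  allᵇ≢true⇒∃ (y ∷ xs) ¬all with p y in py
  ... | false = y , here refl , false≢true py
  ... | true  with x , x∈ , ¬px ← allᵇ≢true⇒∃ xs ¬all = x , there x∈ , ¬px

  ∈-filterᵇ⁻ : ∀ {x} xs → x ∈ filterᵇ p xs → x ∈ xs × p x ≡ true
  ∈-filterᵇ⁻ (y ∷ xs) x∈ with p y in py | x∈
  ... | true  | here refl = here refl , py
  ... | true  | there x∈′ = map₁ there (∈-filterᵇ⁻ xs x∈′)
  ... | false | x∈′       = map₁ there (∈-filterᵇ⁻ xs x∈′)

  ∈-filterᵇ⁺ : ∀ {x xs} → x ∈ xs → p x ≡ true → x ∈ filterᵇ p xs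
  ∈-filterᵇ⁺ {xs = y ∷ xs} x∈ px with p y in py | x∈
  ... | true  | here refl = here refl
  ... | true  | there x∈′ = there (∈-filterᵇ⁺ x∈′ px)
  ... | false | here refl = contradiction px (false≢true py)
  ... | false | there x∈′ = ∈-filterᵇ⁺ x∈′ px

  length-filterᵇ≤ : ∀ xs → length (filterᵇ p xs) ≤ length xs
  length-filterᵇ≤ []       = z≤n
  length-filterᵇ≤ (y ∷ xs) with p y
  ... | true  = s≤s (length-filterᵇ≤ xs)
  ... | false = m≤n⇒m≤1+n (length-filterᵇ≤ xs)

  filterᵇ-none : ∀ {xs} → (∀ {x} → x ∈ xs → p x ≢ true) → filterᵇ p xs ≡ []
  filterᵇ-none {[]}     _    = refl
  filterᵇ-none {y ∷ xs} none with p y in py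
  ... | true  = contradiction py (none (here refl))
  ... | false = filterᵇ-none (none ∘ there)

  filterᵇ-head : ∀ {xs y ys} → AllPairs _<_ xs → filterᵇ p xs ≡ y ∷ ys →
                 y ∈ xs × p y ≡ true × (∀ {x} → x ∈ xs → x < y → p x ≢ true)
  filterᵇ-head {x ∷ xs} (x<xs ∷ sorted) eq with p x in px
  filterᵇ-head {x ∷ xs} (x<xs ∷ sorted) refl | true = here refl , px , earlier
    where
    earlier : ∀ {z} → z ∈ x ∷ xs → z < x → p z ≢ true
    earlier (here refl) z<x = contradiction z<x (<-irrefl refl)
    earlier (there z∈)  z<x = contradiction z<x (<-asym (All.lookup x<xs z∈))
  ... | false with y∈ , py , earlier ← filterᵇ-head sorted eq = there y∈ , py , earlier′
    where
    earlier′ : ∀ {z} → z ∈ x ∷ xs → z < _ → p z ≢ true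
    earlier′ (here refl) _ = false≢true px
    earlier′ (there z∈)    = earlier z∈

  filterᵇ-prefix : ∀ {xs} t → AllPairs (λ x y → p y ≡ true → p x ≡ true) xs → t < length xs →
                   p (at xs (suc t)) ≡ true ⇔ t < length (filterᵇ p xs)
  filterᵇ-prefix {x ∷ xs} t down t<n with p x in px
  filterᵇ-prefix {x ∷ xs} zero    _           _   | true = mk⇔ (λ _ → z<s) (λ _ → px)
  filterᵇ-prefix {x ∷ xs} (suc t) (_ ∷ downs) t<n | true =
    mk⇔ (s≤s ∘ to prefix) (from prefix ∘ s<s⁻¹)
    where
    prefix : p (at xs (suc t)) ≡ true ⇔ t < length (filterᵇ p xs)
    prefix = filterᵇ-prefix t downs (s<s⁻¹ t<n)
  filterᵇ-prefix {x ∷ xs} t (down ∷ _) t<n | false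
    rewrite filterᵇ-none {xs} (λ y∈ py → false≢true px (All.lookup down y∈ py)) =
    mk⇔ (λ pt → contradiction (head t t<n pt) (false≢true px)) λ ()
    where
    head : ∀ t → t < length (x ∷ xs) → p (at (x ∷ xs) (suc t)) ≡ true → p x ≡ true
    head zero    _   = λ px′ → px′
    head (suc t) t<n = All.lookup down (at-∈ xs (s<s⁻¹ t<n))

module _ {p q : ℕ → Bool} (p⇒q : ∀ {z} → p z ≡ true → q z ≡ true) where

  length-filterᵇ-mono : ∀ zs → length (filterᵇ p zs) ≤ length (filterᵇ q zs)
  length-filterᵇ-mono []       = z≤n
  length-filterᵇ-mono (z ∷ zs) with p z in pz | q z in qz
  ... | true  | true  = s≤s (length-filterᵇ-mono zs)
  ... | true  | false = contradiction (p⇒q pz) (false≢true qz)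
  ... | false | true  = m≤n⇒m≤1+n (length-filterᵇ-mono zs)
  ... | false | false = length-filterᵇ-mono zs

  length-filterᵇ-mono-< : ∀ {x zs} → x ∈ zs → p x ≢ true → q x ≡ true →
                          length (filterᵇ p zs) < length (filterᵇ q zs)
  length-filterᵇ-mono-< {zs = z ∷ zs} x∈ ¬px qx with p z in pz | q z in qz | x∈
  ... | true  | false | _         = contradiction (p⇒q pz) (false≢true qz)
  ... | true  | true  | here refl = contradiction pz ¬px
  ... | false | false | here refl = contradiction qx (false≢true qz)
  ... | false | true  | here refl = s≤s (length-filterᵇ-mono zs)
  ... | true  | true  | there x∈′ = s≤s (length-filterᵇ-mono-< x∈′ ¬px qx)
  ... | false | true  | there x∈′ = m<n⇒m<1+n (length-filterᵇ-mono-< x∈′ ¬px qx)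
  ... | false | false | there x∈′ = length-filterᵇ-mono-< x∈′ ¬px qx

maxL-upper : ∀ {x xs} → x ∈ xs → x ≤ maxL xs
maxL-upper {xs = y ∷ xs} (here refl) = m≤m⊔n y (maxL xs)
maxL-upper {xs = y ∷ xs} (there x∈)  = ≤-trans (maxL-upper x∈) (m≤n⊔m y (maxL xs))

maxL-∈ : ∀ xs → xs ≡ [] ⊎ maxL xs ∈ xs
maxL-∈ []       = inj₁ refl
maxL-∈ (y ∷ xs) with maxL-∈ xs | ⊔-sel y (maxL xs)
... | inj₁ refl | _        = inj₂ (here (⊔-identityʳ y))
... | inj₂ _    | inj₁ y⊔m≡y = inj₂ (here y⊔m≡y)
... | inj₂ m∈   | inj₂ y⊔m≡m = inj₂ (there (subst (_∈ xs) (sym y⊔m≡m) m∈))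

length-range : ∀ lo hi → length (range lo hi) ≡ suc hi ∸ lo
length-range lo hi = length-applyUpTo (lo +_) (suc hi ∸ lo)

at-range : ∀ lo hi {t} → t < suc hi ∸ lo → at (range lo hi) (suc t) ≡ lo + t
at-range lo hi = at-applyUpTo (lo +_)

∈-range⇔ : ∀ {lo hi j} → j ∈ range lo hi ⇔ (lo ≤ j × j ≤ hi)
∈-range⇔ {lo} {hi} = mk⇔ sound complete
  where
  sound : ∀ {j} → j ∈ range lo hi → lo ≤ j × j ≤ hi
  sound j∈ with i , i< , refl ← ∈-applyUpTo⁻ (lo +_) j∈ =
    m≤m+n lo i ,
    s≤s⁻¹ (subst (_≤ suc hi) (trans (+-comm (suc i) lo) (+-suc lo i))
      (m≤o∸n⇒m+n≤o (suc i) (<⇒≤ (m∸n≢0⇒n<m (>⇒≢ (<-≤-trans z<s i<)))) i<))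
  complete : ∀ {j} → lo ≤ j × j ≤ hi → j ∈ range lo hi
  complete (lo≤j , j≤hi) =
    subst (_∈ range lo hi) (m+[n∸m]≡n lo≤j) (∈-applyUpTo⁺ (lo +_) (∸-monoˡ-< (s≤s j≤hi) lo≤j))

range-increasing : ∀ lo hi → AllPairs _<_ (range lo hi)
range-increasing lo hi = AllPairs.applyUpTo⁺₁ (lo +_) (suc hi ∸ lo) (λ i<j _ → +-monoʳ-< lo i<j)

-- Right-to-left maxima

IsRLmax : List ℕ → ℕ → Set
IsRLmax xs i = 1 ≤ i × i ≤ length xs × (∀ {j} → i < j → j ≤ length xs → at xs j < at xs i)

RLmax⇔IsRLmax : ∀ xs {i} → RLmax xs i ⇔ IsRLmax xs i
RLmax⇔IsRLmax xs {i} = mk⇔ sound complete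
  where
  sound : RLmax xs i → IsRLmax xs i
  sound rl with 1≤i , rest ← ∧≡true⁻ rl with i≤n , later ← ∧≡true⁻ rest =
    to ≤ᵇ⇔≤ 1≤i , to ≤ᵇ⇔≤ i≤n ,
    λ i<j j≤n → to <ᵇ⇔< (to allᵇ⇔ later (from ∈-range⇔ (i<j , j≤n)))
  complete : IsRLmax xs i → RLmax xs i
  complete (1≤i , i≤n , later) =
    ∧≡true⁺ (from ≤ᵇ⇔≤ 1≤i) (∧≡true⁺ (from ≤ᵇ⇔≤ i≤n) (from allᵇ⇔ λ j∈ →
      from <ᵇ⇔< (later (proj₁ (to ∈-range⇔ j∈)) (proj₂ (to ∈-range⇔ j∈)))))

RLmax⇒later : ∀ xs {i j} → RLmax xs i → i < j → j ≤ length xs → at xs j < at xs i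
RLmax⇒later xs rl = proj₂ (proj₂ (to (RLmax⇔IsRLmax xs) rl))

¬RLmax⇒larger-later : ∀ xs {i} → ¬ RLmax xs i → 1 ≤ i → i ≤ length xs →
                      ∃[ j ] i < j × j ≤ length xs × at xs i ≤ at xs j
¬RLmax⇒larger-later xs {i} ¬rl 1≤i i≤n
  with j , j∈ , ¬j< ← allᵇ≢true⇒∃ (range (suc i) (length xs))
                        (¬rl ∘ ∧≡true⁺ (from ≤ᵇ⇔≤ 1≤i) ∘ ∧≡true⁺ (from ≤ᵇ⇔≤ i≤n)) =
  j , proj₁ (to ∈-range⇔ j∈) , proj₂ (to ∈-range⇔ j∈) , ≮⇒≥ (¬j< ∘ from <ᵇ⇔<)

OrderIsomorphic : List ℕ → List ℕ → Set
OrderIsomorphic xs ys = length xs ≡ length ys ×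
  (∀ {t u} → t < length xs → u < length xs → at xs (suc t) < at xs (suc u) ⇔ at ys (suc t) < at ys (suc u))

OrderIsomorphic-sym : ∀ {xs ys} → OrderIsomorphic xs ys → OrderIsomorphic ys xs
OrderIsomorphic-sym (len≡ , iso) = sym len≡ , λ t< u< →
  ⇔-sym (iso (subst (_ <_) (sym len≡) t<) (subst (_ <_) (sym len≡) u<))

OrderIsomorphic⇒IsRLmax : ∀ {xs ys i} → OrderIsomorphic xs ys → IsRLmax xs i → IsRLmax ys i
OrderIsomorphic⇒IsRLmax {xs} {ys} {suc t} (len≡ , iso) (1≤i , i≤n , later) =
  1≤i , subst (suc t ≤_) len≡ i≤n , later′
  where
  later′ : ∀ {j} → suc t < j → j ≤ length ys → at ys j < at ys (suc t)
  later′ {suc u} i<j j≤n with u<n ← subst (suc u ≤_) (sym len≡) j≤n = to (iso u<n i≤n) (later i<j u<n)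

RLmax-last : ∀ {xs} → 1 ≤ length xs → RLmax xs (length xs)
RLmax-last {xs} 1≤n = from (RLmax⇔IsRLmax xs) (1≤n , ≤-refl , λ n<j j≤n → contradiction j≤n (<⇒≱ n<j))

≢decr⇒nonempty : ∀ {xs} → xs ≢ decr (length xs) → 1 ≤ length xs
≢decr⇒nonempty {[]}    ≢decr = contradiction refl ≢decr
≢decr⇒nonempty {_ ∷ _} _     = z<s

rank : List ℕ → ℕ → ℕ
rank zs x = length (filterᵇ (_<ᵇ x) zs)

rank-mono-≤ : ∀ zs {x y} → x ≤ y → rank zs x ≤ rank zs y
rank-mono-≤ zs x≤y = length-filterᵇ-mono (λ z<x → from <ᵇ⇔< (<-≤-trans (to <ᵇ⇔< z<x) x≤y)) zs

rank-mono-< : ∀ zs {x y} → x ∈ zs → x < y → rank zs x < rank zs y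
rank-mono-< zs {x} x∈ x<y = length-filterᵇ-mono-< (λ z<x → from <ᵇ⇔< (<-trans (to <ᵇ⇔< z<x) x<y))
  x∈ (<-irrefl refl ∘ to (<ᵇ⇔< {x})) (from <ᵇ⇔< x<y)

std-orderIsomorphic : ∀ xs → OrderIsomorphic xs (std xs)
std-orderIsomorphic xs = sym (length-map _ xs) , λ {t} {u} t<n u<n →
  subst₂ (λ a b → at xs (suc t) < at xs (suc u) ⇔ a < b)
    (sym (at-map (suc ∘ rank xs) xs t<n)) (sym (at-map (suc ∘ rank xs) xs u<n))
    (mk⇔ (s≤s ∘ rank-mono-< xs (at-∈ xs t<n)) (rank-reflects-< ∘ s<s⁻¹))
  where
  rank-reflects-< : ∀ {x y} → rank xs x < rank xs y → x < y
  rank-reflects-< {x} {y} r< with x <? y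
  ... | yes x<y = x<y
  ... | no  x≮y = contradiction (rank-mono-≤ xs (≮⇒≥ x≮y)) (<⇒≱ r<)

RLmax-std : ∀ {xs i} → RLmax (std xs) i ⇔ IsRLmax xs i
RLmax-std {xs} = ⇔-trans (RLmax⇔IsRLmax (std xs))
  (mk⇔ (OrderIsomorphic⇒IsRLmax {std xs} {xs} (OrderIsomorphic-sym {xs} {std xs} (std-orderIsomorphic xs)))
       (OrderIsomorphic⇒IsRLmax {xs} {std xs} (std-orderIsomorphic xs)))

RLmaxWithin : List ℕ → List ℕ → ℕ → Set
RLmaxWithin π idx x = ∀ {y} → y ∈ idx → x < y → at π y < at π x

RLmax⇒RLmaxWithin : ∀ {π idx x} → RLmax π x → (∀ {y} → y ∈ idx → y ≤ length π) → RLmaxWithin π idx x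
RLmax⇒RLmaxWithin {π} rl bounded y∈ x<y = RLmax⇒later π rl x<y (bounded y∈)

IsRLmax-subsequence : ∀ π {idx i} → AllPairs _<_ idx →
  IsRLmax (map (at π) idx) i ⇔ (1 ≤ i × i ≤ length idx × RLmaxWithin π idx (at idx i))
IsRLmax-subsequence π {idx} increasing = mk⇔ sound complete
  where
  len≡ : length (map (at π) idx) ≡ length idx
  len≡ = length-map (at π) idx
  ordered : ∀ {t u} → t < u → u < length idx → at idx (suc t) < at idx (suc u)
  ordered = to AllPairs⇔at increasing
  sound : ∀ {i} → IsRLmax (map (at π) idx) i → 1 ≤ i × i ≤ length idx × RLmaxWithin π idx (at idx i)
  sound {suc t} (1≤i , t<n , later) = 1≤i , t<n′ , within
    where
    t<n′ : t < length idx
    t<n′ = subst (suc t ≤_) len≡ t<n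
    within : RLmaxWithin π idx (at idx (suc t))
    within y∈ x<y with u , u<n , refl ← ∈⇒at y∈ with <-cmp t u
    ... | tri< t<u _ _  = subst₂ _<_ (at-map (at π) idx u<n) (at-map (at π) idx t<n′)
                            (later (s≤s t<u) (subst (suc u ≤_) (sym len≡) u<n))
    ... | tri≈ _ refl _ = contradiction x<y (<-irrefl refl)
    ... | tri> _ _ u<t  = contradiction x<y (<-asym (ordered u<t t<n′))
  complete : ∀ {i} → 1 ≤ i × i ≤ length idx × RLmaxWithin π idx (at idx i) → IsRLmax (map (at π) idx) i
  complete {suc t} (1≤i , t<n , within) = 1≤i , subst (suc t ≤_) (sym len≡) t<n , later
    where
    later : ∀ {j} → suc t < j → j ≤ length (map (at π) idx) →
            at (map (at π) idx) j < at (map (at π) idx) (suc t)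
    later {suc u} t<u j≤n with u<n ← subst (suc u ≤_) len≡ j≤n =
      subst₂ _<_ (sym (at-map (at π) idx u<n)) (sym (at-map (at π) idx t<n))
        (within (at-∈ idx u<n) (ordered (s<s⁻¹ t<u) u<n))

RLmax-std-subsequence : ∀ π {idx i} → AllPairs _<_ idx →
  RLmax (std (map (at π) idx)) i ⇔ (1 ≤ i × i ≤ length idx × RLmaxWithin π idx (at idx i))
RLmax-std-subsequence π {idx} increasing =
  ⇔-trans (RLmax-std {map (at π) idx}) (IsRLmax-subsequence π increasing)

allRLmax⇒decreasing : ∀ {xs} → (∀ {i} → 1 ≤ i → i ≤ length xs → RLmax xs i) → AllPairs _>_ xs
allRLmax⇒decreasing {xs} allRL = from AllPairs⇔at λ t<u u<n →
  RLmax⇒later xs (allRL z<s (<-trans t<u u<n)) (s≤s t<u) u<n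

decreasingPerm≡decr : ∀ {n xs} → IsPerm n xs → AllPairs _>_ xs → xs ≡ decr n
decreasingPerm≡decr {n} perm decreasing = ≋⇒≡ (↗↭↗⇒≋ ≥-totalOrder (sorted decreasing)
  (sorted (subst (AllPairs _>_) (sym (reverse-applyUpTo suc n))
                 (AllPairs.applyDownFrom⁺₁ suc n λ j<i _ → s≤s j<i)))
  (↭⇒↭ₛ (↭-trans perm (↭-sym (↭-reverse (range 1 n))))))
  where
  sorted : ∀ {ys} → AllPairs _>_ ys → Sorted ≥-totalOrder ys
  sorted = AllPairs⇒Sorted ≥-totalOrder ∘ AllPairs.map <⇒≤

IsPerm⇒length : ∀ {n π} → IsPerm n π → length π ≡ n
IsPerm⇒length {n} perm = trans (↭-length perm) (length-range 1 n)

IsPerm⇒Unique : ∀ {n π} → IsPerm n π → Unique π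
IsPerm⇒Unique {n} perm = Unique-resp-↭ (↭⇒↭ₛ (↭-sym perm)) (AllPairs.map <⇒≢ (range-increasing 1 n))

Unique⇒at-≢ : ∀ {xs i j} → Unique xs → 1 ≤ i → i < j → j ≤ length xs → at xs i ≢ at xs j
Unique⇒at-≢ {i = suc t} {suc u} unique _ i<j j≤n = to AllPairs⇔at unique (s<s⁻¹ i<j) j≤n

-- The decomposition at φ(π) = (a, b)

module Decomposition (π : List ℕ) (π-perm : IsPerm (length π) π) (π≢decr : π ≢ decr (length π)) where

  n a b χ ρ : ℕ
  n = length π
  a = phiA π
  b = phiB π
  χ = chi π
  ρ = rho π

  1≤n : 1 ≤ n
  1≤n = ≢decr⇒nonempty π≢decr

  RLmaxSuffixᵇ : ℕ → Bool
  RLmaxSuffixᵇ c = allᵇ (isRL π) (range c n)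

  phiB-least : b ∈ range 1 n × RLmaxSuffixᵇ b ≡ true ×
               (∀ {c} → c ∈ range 1 n → c < b → RLmaxSuffixᵇ c ≢ true)
  phiB-least with filterᵇ RLmaxSuffixᵇ (range 1 n) in eq
  ... | _ ∷ _ = filterᵇ-head (range-increasing 1 n) eq
  ... | []    = contradiction (subst (n ∈_) eq (∈-filterᵇ⁺ (from ∈-range⇔ (1≤n , ≤-refl)) suffixₙ)) λ ()
    where
    suffixₙ : RLmaxSuffixᵇ n ≡ true
    suffixₙ = from (allᵇ⇔ {xs = range n n}) λ c∈ →
      subst (RLmax π) (≤-antisym (proj₁ (to ∈-range⇔ c∈)) (proj₂ (to ∈-range⇔ c∈))) (RLmax-last {π} 1≤n)

  1≤b : 1 ≤ b
  1≤b = proj₁ (to ∈-range⇔ (proj₁ phiB-least))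

  b≤n : b ≤ n
  b≤n = proj₂ (to ∈-range⇔ (proj₁ phiB-least))

  RLmax-from-b : ∀ {i} → b ≤ i → i ≤ n → RLmax π i
  RLmax-from-b b≤i i≤n = to (allᵇ⇔ {xs = range b n}) (proj₁ (proj₂ phiB-least)) (from ∈-range⇔ (b≤i , i≤n))

  ≤π[b] : ∀ {j} → b ≤ j → j ≤ n → at π j ≤ at π b
  ≤π[b] b≤j j≤n with m≤n⇒m<n∨m≡n b≤j
  ... | inj₁ b<j  = <⇒≤ (RLmax⇒later π (RLmax-from-b ≤-refl b≤n) b<j j≤n)
  ... | inj₂ refl = ≤-refl

  2≤b : 2 ≤ b
  2≤b = ≰⇒> λ b≤1 → π≢decr (decreasingPerm≡decr π-perm
    (allRLmax⇒decreasing λ 1≤i i≤n → RLmax-from-b (≤-trans b≤1 1≤i) i≤n))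

  b∸1<b : b ∸ 1 < b
  b∸1<b = to (≤∸1⇔< 1≤b) ≤-refl

  b∸1-notRLmax : ¬ RLmax π (b ∸ 1)
  b∸1-notRLmax rl
    with x , x∈ , ¬rl ← allᵇ≢true⇒∃ (range (b ∸ 1) n)
           (proj₂ (proj₂ phiB-least)
             (from ∈-range⇔ (from (≤∸1⇔< 1≤b) 2≤b , ≤-trans (<⇒≤ b∸1<b) b≤n)) b∸1<b)
    with b∸1≤x , x≤n ← to ∈-range⇔ x∈ with b ≤? x
  ... | yes b≤x = ¬rl (RLmax-from-b b≤x x≤n)
  ... | no  b≰x = ¬rl (subst (RLmax π) (≤-antisym b∸1≤x (from (≤∸1⇔< 1≤b) (≰⇒> b≰x))) rl)

  ∈-range-below-b⇔ : ∀ {lo j} → j ∈ range lo (b ∸ 1) ⇔ (lo ≤ j × j < b)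
  ∈-range-below-b⇔ = ⇔-trans ∈-range⇔ (mk⇔ (map₂ (to (≤∸1⇔< 1≤b))) (map₂ (from (≤∸1⇔< 1≤b))))

  RLmax-below-b⇒≤a : ∀ {i} → 1 ≤ i → i < b → RLmax π i → i ≤ a
  RLmax-below-b⇒≤a 1≤i i<b rl =
    maxL-upper (∈-filterᵇ⁺ {xs = range 1 (b ∸ 1)} (from ∈-range-below-b⇔ (1≤i , i<b)) rl)

  a<b∸1 : a < b ∸ 1
  a<b∸1 with maxL-∈ (filterᵇ (isRL π) (range 1 (b ∸ 1)))
  ... | inj₁ none = subst (_< b ∸ 1) (sym (cong maxL none)) (from (≤∸1⇔< 1≤b) 2≤b)
  ... | inj₂ a∈ with a∈range , rl ← ∈-filterᵇ⁻ {p = isRL π} (range 1 (b ∸ 1)) a∈ =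
    ≤∧≢⇒< (proj₂ (to ∈-range⇔ a∈range)) λ a≡b∸1 → b∸1-notRLmax (subst (RLmax π) a≡b∸1 rl)

  a<b : a < b
  a<b = <-trans a<b∸1 b∸1<b

  between-notRLmax : ∀ {i} → a < i → i < b → ¬ RLmax π i
  between-notRLmax a<i i<b rl = <⇒≱ a<i (RLmax-below-b⇒≤a (≤-trans (s≤s z≤n) a<i) i<b rl)

  ≤χ : ∀ {i} → a < i → i < b → at π i ≤ χ
  ≤χ a<i i<b = maxL-upper (∈-map⁺ (at π) (from (∈-range-below-b⇔ {suc a}) (a<i , i<b)))

  χ-attained : ∃[ k ] a < k × k < b × at π k ≡ χ
  χ-attained with maxL-∈ (map (at π) (range (suc a) (b ∸ 1)))
  ... | inj₁ none =
    contradiction (subst (at π (suc a) ∈_) none (∈-map⁺ (at π) (from ∈-range⇔ (≤-refl , a<b∸1)))) λ ()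
  ... | inj₂ χ∈ with k , k∈ , χ≡ ← ∈-map⁻ (at π) χ∈ =
    k , proj₁ (to ∈-range-below-b⇔ k∈) , proj₂ (to ∈-range-below-b⇔ k∈) , sym χ≡

  χ<π[b] : χ < at π b
  χ<π[b] with k , a<k , k<b , π[k]≡χ ← χ-attained
    with j , k<j , j≤n , π[k]≤π[j] ← ¬RLmax⇒larger-later π (between-notRLmax a<k k<b)
                                        (≤-trans z<s a<k) (≤-trans (<⇒≤ k<b) b≤n) =
    subst (_< at π b) π[k]≡χ
      (≤∧≢⇒< (≤-trans π[k]≤π[j] (≤π[b] b≤j j≤n)) (Unique⇒at-≢ unique 1≤k k<b b≤n))
    where
    unique : Unique π
    unique = IsPerm⇒Unique π-perm
    1≤k : 1 ≤ k
    1≤k = ≤-trans (s≤s z≤n) a<k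
    b≤j : b ≤ j
    b≤j = ≮⇒≥ λ j<b → Unique⇒at-≢ unique 1≤k k<j j≤n
      (≤-antisym π[k]≤π[j] (subst (at π j ≤_) (sym π[k]≡χ) (≤χ (<-trans a<k k<j) j<b)))

  -- rho π counts the indices in (b, n] satisfying χ<ᵇπ; since π decreases on [b, n], they form an
  -- initial segment.
  χ<ᵇπ : ℕ → Bool
  χ<ᵇπ i = isRL π i ∧ (χ <ᵇ at π i)

  b+ρ≤n : b + ρ ≤ n
  b+ρ≤n = begin
    b + ρ                         ≤⟨ +-monoʳ-≤ b (length-filterᵇ≤ {χ<ᵇπ} (range (suc b) n)) ⟩
    b + length (range (suc b) n)  ≡⟨ cong (b +_) (length-range (suc b) n) ⟩
    b + (n ∸ b)                   ≡⟨ m+[n∸m]≡n b≤n ⟩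
    n                             ∎
    where open ≤-Reasoning

  χ<ᵇπ-downClosed : AllPairs (λ x y → χ<ᵇπ y ≡ true → χ<ᵇπ x ≡ true) (range (suc b) n)
  χ<ᵇπ-downClosed = AllPairs-<⇒ (range-increasing (suc b) n) down
    where
    down : ∀ {x y} → x ∈ range (suc b) n → y ∈ range (suc b) n → x < y → χ<ᵇπ y ≡ true → χ<ᵇπ x ≡ true
    down {x} x∈ y∈ x<y py with b<x , _ ← to ∈-range⇔ x∈ | _ , y≤n ← to ∈-range⇔ y∈ =
      ∧≡true⁺ rl (from <ᵇ⇔< (<-trans (to <ᵇ⇔< (proj₂ (∧≡true⁻ py))) (RLmax⇒later π rl x<y y≤n)))
      where
      rl : RLmax π x
      rl = RLmax-from-b (<⇒≤ b<x) (≤-trans (<⇒≤ x<y) y≤n)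

  χ<π⇔≤b+ρ : ∀ {i} → b < i → i ≤ n → χ < at π i ⇔ i ≤ b + ρ
  χ<π⇔≤b+ρ b<i i≤n with t , refl ← m≤n⇒∃[o]m+o≡n b<i =
    ⇔-trans (subst (λ x → χ < at π (suc b + t) ⇔ χ<ᵇπ x ≡ true) (sym at≡)
               (mk⇔ (∧≡true⁺ rl ∘ from <ᵇ⇔<) (to <ᵇ⇔< ∘ proj₂ ∘ ∧≡true⁻)))
    (⇔-trans (filterᵇ-prefix t χ<ᵇπ-downClosed t<len)
             (mk⇔ (+-monoʳ-< b) (+-cancelˡ-< b t ρ)))
    where
    t<n∸b : t < n ∸ b
    t<n∸b = m+n≤o⇒m≤o∸n (suc t) (subst (_≤ n) (cong suc (+-comm b t)) i≤n)
    t<len : t < length (range (suc b) n)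
    t<len = subst (t <_) (sym (length-range (suc b) n)) t<n∸b
    at≡ : at (range (suc b) n) (suc t) ≡ suc b + t
    at≡ = at-range (suc b) n t<n∸b
    rl : RLmax π (suc b + t)
    rl = RLmax-from-b (<⇒≤ b<i) i≤n

  outside-block-≤χ : ∀ {j} → a < j → j ≤ n → j < b ⊎ b + ρ < j → at π j ≤ χ
  outside-block-≤χ a<j _   (inj₁ j<b)   = ≤χ a<j j<b
  outside-block-≤χ _   j≤n (inj₂ b+ρ<j) =
    ≮⇒≥ λ χ<π[j] → <⇒≱ b+ρ<j (to (χ<π⇔≤b+ρ (≤-<-trans (m≤m+n b ρ) b+ρ<j) j≤n) χ<π[j])

  idx₁ : List ℕ
  idx₁ = range 1 a ++ range b (b + ρ)

  idx₁-increasing : AllPairs _<_ idx₁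
  idx₁-increasing = AllPairs.++⁺ (range-increasing 1 a) (range-increasing b (b + ρ))
    (All.tabulate λ x∈ → All.tabulate λ y∈ →
      <-≤-trans (≤-<-trans (proj₂ (to ∈-range⇔ x∈)) a<b) (proj₁ (to ∈-range⇔ y∈)))

  idx₁-bounded : ∀ {y} → y ∈ idx₁ → y ≤ n
  idx₁-bounded y∈ with ∈-++⁻ (range 1 a) y∈
  ... | inj₁ y∈ˡ = ≤-trans (proj₂ (to ∈-range⇔ y∈ˡ)) (≤-trans (<⇒≤ a<b) b≤n)
  ... | inj₂ y∈ʳ = ≤-trans (proj₂ (to ∈-range⇔ y∈ʳ)) b+ρ≤n

  length-idx₁ : length idx₁ ≡ a + ρ + 1
  length-idx₁ = begin
    length idx₁                                        ≡⟨ length-++ (range 1 a) ⟩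
    length (range 1 a) + length (range b (b + ρ))      ≡⟨ cong₂ _+_ (length-range 1 a) (length-range b (b + ρ)) ⟩
    a + (suc (b + ρ) ∸ b)                              ≡⟨ cong (λ m → a + (m ∸ b)) (sym (+-suc b ρ)) ⟩
    a + (b + suc ρ ∸ b)                                ≡⟨ cong (a +_) (m+n∸m≡n b (suc ρ)) ⟩
    a + suc ρ                                          ≡⟨ +-suc a ρ ⟩
    suc (a + ρ)                                        ≡⟨ +-comm 1 (a + ρ) ⟩
    a + ρ + 1                                          ∎
    where open ≡-Reasoning

  at-idx₁-prefix : ∀ {i} → 1 ≤ i → i ≤ a → at idx₁ i ≡ i
  at-idx₁-prefix {suc t} _ i≤a =
    trans (at-++ˡ {range 1 a} (subst (t <_) (sym (length-range 1 a)) i≤a)) (at-range 1 a i≤a)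

  at-idx₁-∈block : ∀ {i} → a < i → i ≤ length idx₁ → at idx₁ i ∈ range b (b + ρ)
  at-idx₁-∈block a<i = at-++-∈ʳ (range 1 a) (subst (_< _) (sym (length-range 1 a)) a<i)

  RLmaxWithin-idx₁⇒RLmax : ∀ {i} → 1 ≤ i → i ≤ a → RLmaxWithin π idx₁ i → RLmax π i
  RLmaxWithin-idx₁⇒RLmax {i} 1≤i i≤a within =
    from (RLmax⇔IsRLmax π) (1≤i , ≤-trans i≤a (≤-trans (<⇒≤ a<b) b≤n) , later)
    where
    π[b]<π[i] : at π b < at π i
    π[b]<π[i] = within (∈-++⁺ʳ (range 1 a) (from ∈-range⇔ (≤-refl , m≤m+n b ρ))) (≤-<-trans i≤a a<b)
    below-π[i] : ∀ {j} → a < j → j ≤ n → j < b ⊎ b + ρ < j → at π j < at π i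
    below-π[i] a<j j≤n outside = ≤-<-trans (outside-block-≤χ a<j j≤n outside) (<-trans χ<π[b] π[b]<π[i])
    later : ∀ {j} → i < j → j ≤ n → at π j < at π i
    later {j} i<j j≤n with j ≤? a | j <? b | j ≤? b + ρ
    ... | yes j≤a | _       | _         = within (∈-++⁺ˡ (from ∈-range⇔ (≤-trans 1≤i (<⇒≤ i<j) , j≤a))) i<j
    ... | no  j≰a | yes j<b | _         = below-π[i] (≰⇒> j≰a) j≤n (inj₁ j<b)
    ... | no  _   | no  j≮b | yes j≤b+ρ = within (∈-++⁺ʳ (range 1 a) (from ∈-range⇔ (≮⇒≥ j≮b , j≤b+ρ))) i<j
    ... | no  j≰a | no  _   | no  j≰b+ρ = below-π[i] (≰⇒> j≰a) j≤n (inj₂ (≰⇒> j≰b+ρ))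

  RLmax-pi1 : ∀ i → RLmax (pi1 π) i ⇔ ((RLmax π i × ¬ (b ≤ i × i ≤ n)) ⊎ (a + 1 ≤ i × i ≤ a + ρ + 1))
  RLmax-pi1 i = ⇔-trans (RLmax-std-subsequence π idx₁-increasing) (mk⇔ sound complete)
    where
    sound : 1 ≤ i × i ≤ length idx₁ × RLmaxWithin π idx₁ (at idx₁ i) →
            (RLmax π i × ¬ (b ≤ i × i ≤ n)) ⊎ (a + 1 ≤ i × i ≤ a + ρ + 1)
    sound (1≤i , i≤len , within) with i ≤? a
    ... | yes i≤a =
      inj₁ (RLmaxWithin-idx₁⇒RLmax 1≤i i≤a (subst (RLmaxWithin π idx₁) (at-idx₁-prefix 1≤i i≤a) within) ,
            λ (b≤i , _) → <⇒≱ (≤-<-trans i≤a a<b) b≤i)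
    ... | no  i≰a = inj₂ (subst (_≤ i) (+-comm 1 a) (≰⇒> i≰a) , subst (i ≤_) length-idx₁ i≤len)
    complete : (RLmax π i × ¬ (b ≤ i × i ≤ n)) ⊎ (a + 1 ≤ i × i ≤ a + ρ + 1) →
               1 ≤ i × i ≤ length idx₁ × RLmaxWithin π idx₁ (at idx₁ i)
    complete (inj₁ (rl , ¬block)) with 1≤i , i≤n , _ ← to (RLmax⇔IsRLmax π) rl =
      1≤i , subst (i ≤_) (sym length-idx₁) (≤-trans i≤a (≤-trans (m≤m+n a ρ) (m≤m+n (a + ρ) 1))) ,
      subst (RLmaxWithin π idx₁) (sym (at-idx₁-prefix 1≤i i≤a)) (RLmax⇒RLmaxWithin {π} rl idx₁-bounded)
      where
      i≤a : i ≤ a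
      i≤a = RLmax-below-b⇒≤a 1≤i (≰⇒> λ b≤i → ¬block (b≤i , i≤n)) rl
    complete (inj₂ (a+1≤i , i≤m)) with i≤len ← subst (i ≤_) (sym length-idx₁) i≤m
      with b≤at , at≤b+ρ ← to ∈-range⇔ (at-idx₁-∈block (subst (_≤ i) (+-comm a 1) a+1≤i) i≤len) =
      ≤-trans (m≤n+m 1 a) a+1≤i , i≤len ,
      RLmax⇒RLmaxWithin {π} (RLmax-from-b b≤at (≤-trans at≤b+ρ b+ρ≤n)) idx₁-bounded

  idx₂ : List ℕ
  idx₂ = range (suc a) b ++ range (suc (b + ρ)) n

  idx₂-increasing : AllPairs _<_ idx₂
  idx₂-increasing = AllPairs.++⁺ (range-increasing (suc a) b) (range-increasing (suc (b + ρ)) n)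
    (All.tabulate λ x∈ → All.tabulate λ y∈ →
      <-≤-trans (s≤s (≤-trans (proj₂ (to ∈-range⇔ x∈)) (m≤m+n b ρ))) (proj₁ (to ∈-range⇔ y∈)))

  idx₂-bounded : ∀ {y} → y ∈ idx₂ → y ≤ n
  idx₂-bounded y∈ with ∈-++⁻ (range (suc a) b) y∈
  ... | inj₁ y∈ˡ = ≤-trans (proj₂ (to ∈-range⇔ y∈ˡ)) b≤n
  ... | inj₂ y∈ʳ = proj₂ (to ∈-range⇔ y∈ʳ)

  length-idx₂ : length idx₂ ≡ n ∸ a ∸ ρ
  length-idx₂ = begin
    length idx₂
      ≡⟨ length-++ (range (suc a) b) ⟩
    length (range (suc a) b) + length (range (suc (b + ρ)) n)
      ≡⟨ cong₂ _+_ (length-range (suc a) b) (length-range (suc (b + ρ)) n) ⟩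
    (b ∸ a) + (n ∸ (b + ρ))
      ≡⟨ ∸-split a b ρ n (<⇒≤ a<b) b+ρ≤n ⟩
    n ∸ a ∸ ρ                                                    ∎
    where open ≡-Reasoning

  at-idx₂-prefix : ∀ {i} → 1 ≤ i → i ≤ b ∸ a → at idx₂ i ≡ a + i
  at-idx₂-prefix {suc t} _ i≤b∸a =
    trans (at-++ˡ {range (suc a) b} (subst (t <_) (sym (length-range (suc a) b)) i≤b∸a))
          (trans (at-range (suc a) b i≤b∸a) (sym (+-suc a t)))

  at-idx₂-suffix : ∀ {i} → b ∸ a ≤ i → i ≤ length idx₂ → b ≤ at idx₂ i × at idx₂ i ≤ n
  at-idx₂-suffix {i} b∸a≤i i≤len with i ≤? b ∸ a
  ... | yes i≤b∸a with refl ← ≤-antisym i≤b∸a b∸a≤i =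
    subst (λ x → b ≤ x × x ≤ n) (sym at≡b) (≤-refl , b≤n)
    where
    at≡b : at idx₂ (b ∸ a) ≡ b
    at≡b = trans (at-idx₂-prefix (m<n⇒0<n∸m a<b) ≤-refl) (m+[n∸m]≡n (<⇒≤ a<b))
  ... | no  i≰b∸a with b+ρ<y , y≤n ← to ∈-range⇔ (at-++-∈ʳ (range (suc a) b)
                                       (subst (_< i) (sym (length-range (suc a) b)) (≰⇒> i≰b∸a)) i≤len) =
    ≤-trans (m≤m+n b ρ) (<⇒≤ b+ρ<y) , y≤n

  between-notRLmaxWithin-idx₂ : ∀ {k} → a < k → k < b → ¬ RLmaxWithin π idx₂ k
  between-notRLmaxWithin-idx₂ {k} a<k k<b within
    with j , k<j , j≤n , π[k]≤π[j] ← ¬RLmax⇒larger-later π (between-notRLmax a<k k<b)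
                                        (≤-trans z<s a<k) (≤-trans (<⇒≤ k<b) b≤n)
    with j ≤? b | j ≤? b + ρ
  ... | yes j≤b | _         = <⇒≱ (within (∈-++⁺ˡ (from ∈-range⇔ (<-trans a<k k<j , j≤b))) k<j) π[k]≤π[j]
  ... | no  j≰b | yes _     = <⇒≱ (<-trans π[j]<π[b] π[b]<π[k]) π[k]≤π[j]
    where
    π[j]<π[b] : at π j < at π b
    π[j]<π[b] = RLmax⇒later π (RLmax-from-b ≤-refl b≤n) (≰⇒> j≰b) j≤n
    π[b]<π[k] : at π b < at π k
    π[b]<π[k] = within (∈-++⁺ˡ (from ∈-range⇔ (a<b , ≤-refl))) k<b
  ... | no  _   | no  j≰b+ρ =
    <⇒≱ (within (∈-++⁺ʳ (range (suc a) b) (from ∈-range⇔ (≰⇒> j≰b+ρ , j≤n))) k<j) π[k]≤π[j]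

  RLmax-pi2 : ∀ i → RLmax (pi2 π) i ⇔ (b ∸ a ≤ i × i ≤ n ∸ a ∸ ρ)
  RLmax-pi2 i = ⇔-trans (RLmax-std-subsequence π idx₂-increasing) (mk⇔ sound complete)
    where
    sound : 1 ≤ i × i ≤ length idx₂ × RLmaxWithin π idx₂ (at idx₂ i) → b ∸ a ≤ i × i ≤ n ∸ a ∸ ρ
    sound (1≤i , i≤len , within) = ≮⇒≥ prefix-excluded , subst (i ≤_) length-idx₂ i≤len
      where
      prefix-excluded : ¬ i < b ∸ a
      prefix-excluded i<b∸a = between-notRLmaxWithin-idx₂ (m<m+n a 1≤i)
        (<-≤-trans (+-monoʳ-< a i<b∸a) (≤-reflexive (m+[n∸m]≡n (<⇒≤ a<b))))
        (subst (RLmaxWithin π idx₂) (at-idx₂-prefix 1≤i (<⇒≤ i<b∸a)) within)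
    complete : b ∸ a ≤ i × i ≤ n ∸ a ∸ ρ → 1 ≤ i × i ≤ length idx₂ × RLmaxWithin π idx₂ (at idx₂ i)
    complete (b∸a≤i , i≤l) with i≤len ← subst (i ≤_) (sym length-idx₂) i≤l
      with b≤at , at≤n ← at-idx₂-suffix b∸a≤i i≤len =
      ≤-trans (m<n⇒0<n∸m a<b) b∸a≤i , i≤len ,
      RLmax⇒RLmaxWithin {π} (RLmax-from-b b≤at at≤n) idx₂-bounded

lemma2 : (n : ℕ) (π : List ℕ) → IsPerm n π → Avoids1423 π → π ≢ decr n →
    let a = phiA π
        b = phiB π
        m = a + rho π + 1
        l = n ∸ a ∸ rho π
    in ((i : ℕ) → RLmax (pi1 π) i ⇔ ((RLmax π i × ¬ (b ≤ i × i ≤ n)) ⊎ (a + 1 ≤ i × i ≤ m)))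
       × ((i : ℕ) → RLmax (pi2 π) i ⇔ (b ∸ a ≤ i × i ≤ l))
lemma2 n π perm _ π≢decr with refl ← IsPerm⇒length perm = RLmax-pi1 , RLmax-pi2
  where open Decomposition π perm π≢decr
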